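{- Let $k \ge 2$ and let $G = C_{3k} \square P_2$ with vertices $x_i, y_i$ ($i \in \mathbb{Z}_{3k}$), where $x_i x_{i+1}$, $y_i y_{i+1}$ and $x_i y_i$ are the edges. Then $\mathrm{SIC\%}(G) = \frac{2}{3}$ (i.e. $\mathrm{SIC}(G) = 4k$), and the minimum self-identifying code is unique up to isomorphism: every self-identifying code of $G$ of size $4k$ is the image under an automorphism of $G$ of $V(G) \setminus \{x_i, y_i : i \equiv 0 \pmod 3\}$.
   Context: $N[v] = N(v) \cup \{v\}$; $N_S[v] = N[v] \cap S$. A set $S \subseteq V(G)$ is a self-identifying code (SIC) if for every $x \in V(G)$, $N_S[x] \neq \varnothing$ and $\bigcap_{v \in N_S[x]} N[v] = \{x\}$. $\mathrm{SIC}(G)$ is the minimum cardinality of an SIC and, for finite $G$, $\mathrm{SIC\%}(G) = \mathrm{SIC}(G)/|V(G)|$. $C_{3k} \square P_2$ is the Cartesian product of a cycle of length $3k$ with an edge (the prism). -}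

module Defs where

open import Data.Bool using (Bool; true; false; if_then_else_; not)
open import Data.Nat using (ℕ; zero; suc; _∸_; _%_; _≡ᵇ_)
open import Data.Fin using (Fin; toℕ)
open import Data.List using (List; map; _++_; allFin)
open import Data.Nat.ListAction using (sum)
open import Data.Product using (_×_; _,_; ∃)
open import Data.Sum using (_⊎_)
open import Relation.Binary.PropositionalEquality using (_≡_; _≢_)
open import Function.Bundles using (_↔_; _⇔_; Inverse)

-- Vertices of C_n □ P_2: (false , i) is x_i, (true , i) is y_i, i ∈ ℤ_n.
V : ℕ → Set
V n = Bool × Fin n

CycSucc : (n : ℕ) → Fin n → Fin n → Set
CycSucc n i j = (toℕ j ≡ suc (toℕ i)) ⊎ ((toℕ i ≡ n ∸ 1) × (toℕ j ≡ 0))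

CycAdj : (n : ℕ) → Fin n → Fin n → Set
CycAdj n i j = CycSucc n i j ⊎ CycSucc n j i

Adj : (n : ℕ) → V n → V n → Set
Adj n (a , i) (b , j) = ((a ≡ b) × CycAdj n i j) ⊎ ((a ≢ b) × (i ≡ j))

InN : (n : ℕ) → V n → V n → Set
InN n v w = (w ≡ v) ⊎ Adj n v w

VSet : ℕ → Set
VSet n = V n → Bool

vertices : (n : ℕ) → List (V n)
vertices n = map (false ,_) (allFin n) ++ map (true ,_) (allFin n)

card : (n : ℕ) → VSet n → ℕ
card n S = sum (map (λ v → if S v then 1 else 0) (vertices n))

-- S is a self-identifying code: for every x, N_S[x] ≠ ∅ and
-- ⋂_{v ∈ N_S[x]} N[v] = {x}
IsSIC : (n : ℕ) → VSet n → Set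
IsSIC n S = (x : V n) →
  (∃ λ v → (S v ≡ true) × InN n x v)
  × ((y : V n) → ((v : V n) → S v ≡ true → InN n x v → InN n v y) ⇔ (y ≡ x))

record Automorphism (n : ℕ) : Set where
  field
    perm : V n ↔ V n
    preserves : (u v : V n) → Adj n u v ⇔ Adj n (Inverse.to perm u) (Inverse.to perm v)

_∈Image[_,_] : {n : ℕ} → V n → Automorphism n → VSet n → Set
w ∈Image[ σ , D ] = ∃ λ v → (D v ≡ true) × (Inverse.to (Automorphism.perm σ) v ≡ w)

D₀ : (n : ℕ) → VSet n
D₀ n (_ , i) = not (toℕ i % 3 ≡ᵇ 0)

module Submission where

-- Call x_{i±1} the cycle neighbours and y_i the twin of x_i.  On a cycle of length at least 5,
-- N[x_{i−1}] ∩ N[x_{i+1}] = {x_i} and N[x_i] ∩ N[y_i] = {x_i, y_i}, so S is self-identifying exactly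
-- when at every vertex either both cycle neighbours are codewords, or the vertex, its twin and one
-- cycle neighbour are.  Hence the cycle neighbours and the twin of every vertex contain at least two
-- codewords; adding this for x_{i+1} and y_{i+1} counts the codewords in the columns i, i+1, i+2, so
-- every window of three consecutive columns holds at least four.  For each offset the k windows
-- starting there partition the 3k columns, whence |S| ≥ 4k; and if |S| = 4k, every window holds exactly
-- four codewords and every vertex exactly two among its cycle neighbours and twin.  A non-codeword then
-- needs both of its cycle neighbours, so its twin is no codeword either: every column is empty or full,
-- any three consecutive columns contain exactly two full ones, the empty columns form one residue class
-- mod 3, and S is a rotation of D₀.

open import Data.Bool using (Bool; true; false; not; T; _∧_; _∨_; if_then_else_)
open import Data.Bool.Properties using (not-¬; ¬-not)
open import Data.Empty using (⊥; ⊥-elim)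
open import Data.Fin using (Fin; toℕ)
open import Data.Fin.Properties using (toℕ-injective; toℕ-fromℕ<; toℕ<n)
open import Data.List using (List; map; _++_; allFin; tabulate)
open import Data.List.Properties using (map-++; map-tabulate; tabulate-cong)
open import Data.Nat
  using (ℕ; zero; suc; _+_; _*_; _∸_; _≤_; _<_; z≤n; s≤s; _%_; _≡ᵇ_; _<ᵇ_; NonZero; >-nonZero⁻¹; ≢-nonZero⁻¹)
open import Data.Nat.DivMod
open import Data.Nat.Divisibility using (m∣m*n)
open import Data.Nat.ListAction using (sum)
open import Data.Nat.ListAction.Properties using (sum-++)
open import Data.Nat.Properties
open import Algebra.Properties.CommutativeSemigroup +-commutativeSemigroup
  using ()
  renaming (interchange to +-interchange; x∙yz≈y∙xz to x+[y+z]≡y+[x+z]; x∙yz≈z∙yx to x+[y+z]≡z+[y+x];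
            xy∙z≈yz∙x to x+y+z≡y+z+x; xy∙z≈xz∙y to x+y+z≡x+z+y)
open import Data.Nat.Tactic.RingSolver using (solve-∀)
open import Data.Product using (Σ; ∃; _×_; _,_; proj₁; proj₂; map₂)
open import Data.Sum using (_⊎_; inj₁; inj₂)
import Data.Sum as Sum
open import Defs
open import Function using (_∘_; case_of_)
open import Function.Bundles using (_⇔_; mk⇔; Equivalence; mk↔ₛ′; Inverse)
open import Relation.Binary.PropositionalEquality
open import Relation.Nullary using (yes; no)

s≢not-s : ∀ {s} → s ≢ not s
s≢not-s = not-¬ refl

not-s≢s : ∀ {s} → not s ≢ s
not-s≢s = s≢not-s ∘ sym

-- Arithmetic on the cycle ℤ_n

module Cycle (n : ℕ) .{{_ : NonZero n}} where

  ⟦_⟧ : ℕ → Fin n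
  ⟦ a ⟧ = a mod n

  toℕ-⟦⟧ : ∀ a → toℕ ⟦ a ⟧ ≡ a % n
  toℕ-⟦⟧ a = toℕ-fromℕ< (m%n<n a n)

  ⟦⟧-cong : ∀ {a b} → a % n ≡ b % n → ⟦ a ⟧ ≡ ⟦ b ⟧
  ⟦⟧-cong {a} {b} e = toℕ-injective (trans (toℕ-⟦⟧ a) (trans e (sym (toℕ-⟦⟧ b))))

  ⟦⟧-injective : ∀ {a b} → ⟦ a ⟧ ≡ ⟦ b ⟧ → a % n ≡ b % n
  ⟦⟧-injective {a} {b} e = trans (sym (toℕ-⟦⟧ a)) (trans (cong toℕ e) (toℕ-⟦⟧ b))

  ⟦toℕ⟧ : ∀ i → ⟦ toℕ i ⟧ ≡ i
  ⟦toℕ⟧ i = toℕ-injective (trans (toℕ-⟦⟧ (toℕ i)) (m<n⇒m%n≡m (toℕ<n i)))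

  %-congʳ-+ : ∀ {a b} c → a % n ≡ b % n → (a + c) % n ≡ (b + c) % n
  %-congʳ-+ {a} {b} c e = begin
    (a + c) % n          ≡⟨ %-distribˡ-+ a c n ⟩
    (a % n + c % n) % n  ≡⟨ cong (λ x → (x + c % n) % n) e ⟩
    (b % n + c % n) % n  ≡⟨ %-distribˡ-+ b c n ⟨
    (b + c) % n          ∎
    where open ≡-Reasoning

  %-congˡ-+ : ∀ {a b} c → a % n ≡ b % n → (c + a) % n ≡ (c + b) % n
  %-congˡ-+ {a} {b} c e = begin
    (c + a) % n  ≡⟨ cong (_% n) (+-comm c a) ⟩
    (a + c) % n  ≡⟨ %-congʳ-+ c e ⟩
    (b + c) % n  ≡⟨ cong (_% n) (+-comm b c) ⟩
    (c + b) % n  ∎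
    where open ≡-Reasoning

  1+[n∸1]≡n : 1 + (n ∸ 1) ≡ n
  1+[n∸1]≡n = m+[n∸m]≡n (>-nonZero⁻¹ n)

  -- Adding (n − 1)·c completes c to the multiple n·c.
  %-cancelʳ-+ : ∀ {a b} c → (a + c) % n ≡ (b + c) % n → a % n ≡ b % n
  %-cancelʳ-+ {a} {b} c e = begin
    a % n                      ≡⟨ [m+kn]%n≡m%n a c n ⟨
    (a + c * n) % n            ≡⟨ cong (_% n) (complete a) ⟩
    (a + c + (n ∸ 1) * c) % n  ≡⟨ %-congʳ-+ ((n ∸ 1) * c) e ⟩
    (b + c + (n ∸ 1) * c) % n  ≡⟨ cong (_% n) (complete b) ⟨
    (b + c * n) % n            ≡⟨ [m+kn]%n≡m%n b c n ⟩
    b % n                      ∎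
    where
    open ≡-Reasoning
    complete : ∀ x → x + c * n ≡ x + c + (n ∸ 1) * c
    complete x = begin
      x + c * n              ≡⟨ cong (x +_) (*-comm c n) ⟩
      x + n * c              ≡⟨ cong (λ m → x + m * c) 1+[n∸1]≡n ⟨
      x + (c + (n ∸ 1) * c)  ≡⟨ +-assoc x c _ ⟨
      x + c + (n ∸ 1) * c    ∎

  ⟦n+a⟧ : ∀ a → ⟦ n + a ⟧ ≡ ⟦ a ⟧
  ⟦n+a⟧ a = ⟦⟧-cong (trans (cong (_% n) (+-comm n a)) ([m+n]%n≡m%n a n))

  ⟦1+[n∸1+a]⟧ : ∀ a → ⟦ 1 + (n ∸ 1 + a) ⟧ ≡ ⟦ a ⟧
  ⟦1+[n∸1+a]⟧ a = trans (cong (λ x → ⟦ x + a ⟧) 1+[n∸1]≡n) (⟦n+a⟧ a)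

  ⟦n∸1+[1+a]⟧ : ∀ a → ⟦ n ∸ 1 + (1 + a) ⟧ ≡ ⟦ a ⟧
  ⟦n∸1+[1+a]⟧ a = trans (cong ⟦_⟧ (+-suc (n ∸ 1) a)) (⟦1+[n∸1+a]⟧ a)

  ⟦a+toℕ⟦b⟧⟧ : ∀ a b → ⟦ a + toℕ ⟦ b ⟧ ⟧ ≡ ⟦ a + b ⟧
  ⟦a+toℕ⟦b⟧⟧ a b = ⟦⟧-cong (%-congˡ-+ a (trans (cong (_% n) (toℕ-⟦⟧ b)) (m%n%n≡m%n b n)))

  ⟦⟧-distinct : ∀ m {d₁ d₂} → d₁ < n → d₂ < n → d₁ ≢ d₂ → ⟦ d₁ + m ⟧ ≢ ⟦ d₂ + m ⟧
  ⟦⟧-distinct m {d₁} {d₂} d₁<n d₂<n d₁≢d₂ e = d₁≢d₂ (begin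
    d₁      ≡⟨ m<n⇒m%n≡m d₁<n ⟨
    d₁ % n  ≡⟨ %-cancelʳ-+ m (⟦⟧-injective e) ⟩
    d₂ % n  ≡⟨ m<n⇒m%n≡m d₂<n ⟩
    d₂      ∎)
    where open ≡-Reasoning

  CycSucc⇔ : ∀ {i j} → CycSucc n i j ⇔ (j ≡ ⟦ 1 + toℕ i ⟧)
  CycSucc⇔ {i} {j} = mk⇔ (λ c → toℕ-injective (trans (succ-% c) (sym (toℕ-⟦⟧ (1 + toℕ i)))))
                         (λ { refl → %-succ (toℕ-⟦⟧ (1 + toℕ i)) })
    where
    succ-% : CycSucc n i j → toℕ j ≡ suc (toℕ i) % n
    succ-% (inj₁ j≡1+i) = trans j≡1+i (sym (m<n⇒m%n≡m (subst (_< n) j≡1+i (toℕ<n j))))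
    succ-% (inj₂ (i≡n∸1 , j≡0)) = begin
      toℕ j              ≡⟨ j≡0 ⟩
      0                  ≡⟨ n%n≡0 n ⟨
      n % n              ≡⟨ cong (_% n) 1+[n∸1]≡n ⟨
      (1 + (n ∸ 1)) % n  ≡⟨ cong (λ x → suc x % n) i≡n∸1 ⟨
      suc (toℕ i) % n    ∎
      where open ≡-Reasoning
    %-succ : toℕ j ≡ suc (toℕ i) % n → CycSucc n i j
    %-succ e with suc (toℕ i) ≟ n
    ... | yes 1+i≡n = inj₂ (cong (_∸ 1) 1+i≡n , trans e (trans (cong (_% n) 1+i≡n) (n%n≡0 n)))
    ... | no  1+i≢n = inj₁ (trans e (m<n⇒m%n≡m (≤∧≢⇒< (toℕ<n i) 1+i≢n)))

  CycSucc-⟦⟧ : ∀ {a j} → CycSucc n ⟦ a ⟧ j ⇔ (j ≡ ⟦ 1 + a ⟧)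
  CycSucc-⟦⟧ {a} = mk⇔ (λ c → trans (Equivalence.to CycSucc⇔ c) (⟦a+toℕ⟦b⟧⟧ 1 a))
                       (λ e → Equivalence.from CycSucc⇔ (trans e (sym (⟦a+toℕ⟦b⟧⟧ 1 a))))

  CycSucc⇒≡pred : ∀ {a j} → CycSucc n j ⟦ a ⟧ → j ≡ ⟦ n ∸ 1 + a ⟧
  CycSucc⇒≡pred {a} {j} c = begin
    j                                ≡⟨ ⟦toℕ⟧ j ⟨
    ⟦ toℕ j ⟧                        ≡⟨ ⟦n∸1+[1+a]⟧ (toℕ j) ⟨
    ⟦ n ∸ 1 + (1 + toℕ j) ⟧          ≡⟨ ⟦a+toℕ⟦b⟧⟧ (n ∸ 1) _ ⟨
    ⟦ n ∸ 1 + toℕ ⟦ 1 + toℕ j ⟧ ⟧    ≡⟨ cong (λ i → ⟦ n ∸ 1 + toℕ i ⟧) a≡1+j ⟨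
    ⟦ n ∸ 1 + toℕ ⟦ a ⟧ ⟧            ≡⟨ ⟦a+toℕ⟦b⟧⟧ (n ∸ 1) a ⟩
    ⟦ n ∸ 1 + a ⟧                    ∎
    where
    open ≡-Reasoning
    a≡1+j : ⟦ a ⟧ ≡ ⟦ 1 + toℕ j ⟧
    a≡1+j = Equivalence.to CycSucc⇔ c

  N-succ : ∀ {s} a → InN n (s , ⟦ a ⟧) (s , ⟦ 1 + a ⟧)
  N-succ a = inj₂ (inj₁ (refl , inj₁ (Equivalence.from CycSucc-⟦⟧ refl)))

  N-pred : ∀ {s} a → InN n (s , ⟦ 1 + a ⟧) (s , ⟦ a ⟧)
  N-pred a = inj₂ (inj₁ (refl , inj₂ (Equivalence.from CycSucc-⟦⟧ refl)))

  N-twin : ∀ {s i} → InN n (s , i) (not s , i)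
  N-twin = inj₂ (inj₂ (s≢not-s , refl))

  InN-sym : ∀ {u v} → InN n u v → InN n v u
  InN-sym (inj₁ refl) = inj₁ refl
  InN-sym (inj₂ (inj₁ (refl , inj₁ c))) = inj₂ (inj₁ (refl , inj₂ c))
  InN-sym (inj₂ (inj₁ (refl , inj₂ c))) = inj₂ (inj₁ (refl , inj₁ c))
  InN-sym (inj₂ (inj₂ (s≢t , refl))) = inj₂ (inj₂ (s≢t ∘ sym , refl))

  N-other-side : ∀ {s t i j} → s ≢ t → InN n (s , i) (t , j) → i ≡ j
  N-other-side s≢t (inj₁ refl) = ⊥-elim (s≢t refl)
  N-other-side s≢t (inj₂ (inj₁ (s≡t , _))) = ⊥-elim (s≢t s≡t)
  N-other-side _   (inj₂ (inj₂ (_ , i≡j))) = i≡j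

  -- The predecessor a − 1 is written n ∸ 1 + a, so that no truncated subtraction occurs.
  closedNeighbourhood : ∀ {s a v} → InN n (s , ⟦ a ⟧) v →
    v ≡ (s , ⟦ a ⟧) ⊎ v ≡ (s , ⟦ 1 + a ⟧) ⊎ v ≡ (s , ⟦ n ∸ 1 + a ⟧) ⊎ v ≡ (not s , ⟦ a ⟧)
  closedNeighbourhood (inj₁ e) = inj₁ e
  closedNeighbourhood (inj₂ (inj₁ (refl , inj₁ c))) = inj₂ (inj₁ (cong (_ ,_) (Equivalence.to CycSucc-⟦⟧ c)))
  closedNeighbourhood (inj₂ (inj₁ (refl , inj₂ c))) = inj₂ (inj₂ (inj₁ (cong (_ ,_) (CycSucc⇒≡pred c))))
  closedNeighbourhood (inj₂ (inj₂ (s≢t , refl))) = inj₂ (inj₂ (inj₂ (cong (_, _) (¬-not (s≢t ∘ sym)))))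

  closedNeighbourhood-1+ : ∀ {s m v} → InN n (s , ⟦ 1 + m ⟧) v →
    v ≡ (s , ⟦ 1 + m ⟧) ⊎ v ≡ (s , ⟦ 2 + m ⟧) ⊎ v ≡ (s , ⟦ m ⟧) ⊎ v ≡ (not s , ⟦ 1 + m ⟧)
  closedNeighbourhood-1+ {s} {m} v∈N with closedNeighbourhood v∈N
  ... | inj₁ e = inj₁ e
  ... | inj₂ (inj₁ e) = inj₂ (inj₁ e)
  ... | inj₂ (inj₂ (inj₁ e)) = inj₂ (inj₂ (inj₁ (trans e (cong (s ,_) (⟦n∸1+[1+a]⟧ m)))))
  ... | inj₂ (inj₂ (inj₂ e)) = inj₂ (inj₂ (inj₂ e))

  module Rotation (e : ℕ) (e≤n : e ≤ n) where

    rotate unrotate : Fin n → Fin n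
    rotate i = ⟦ e + toℕ i ⟧
    unrotate i = ⟦ n ∸ e + toℕ i ⟧

    rotate-unrotate : ∀ i → rotate (unrotate i) ≡ i
    rotate-unrotate i = begin
      ⟦ e + toℕ ⟦ n ∸ e + toℕ i ⟧ ⟧  ≡⟨ ⟦a+toℕ⟦b⟧⟧ e _ ⟩
      ⟦ e + (n ∸ e + toℕ i) ⟧        ≡⟨ cong ⟦_⟧ (+-assoc e (n ∸ e) (toℕ i)) ⟨
      ⟦ e + (n ∸ e) + toℕ i ⟧        ≡⟨ cong (λ m → ⟦ m + toℕ i ⟧) (m+[n∸m]≡n e≤n) ⟩
      ⟦ n + toℕ i ⟧                  ≡⟨ ⟦n+a⟧ (toℕ i) ⟩
      ⟦ toℕ i ⟧                      ≡⟨ ⟦toℕ⟧ i ⟩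
      i                              ∎
      where open ≡-Reasoning

    unrotate-rotate : ∀ i → unrotate (rotate i) ≡ i
    unrotate-rotate i = begin
      ⟦ n ∸ e + toℕ ⟦ e + toℕ i ⟧ ⟧  ≡⟨ ⟦a+toℕ⟦b⟧⟧ (n ∸ e) _ ⟩
      ⟦ n ∸ e + (e + toℕ i) ⟧        ≡⟨ cong ⟦_⟧ (+-assoc (n ∸ e) e (toℕ i)) ⟨
      ⟦ n ∸ e + e + toℕ i ⟧          ≡⟨ cong (λ m → ⟦ m + toℕ i ⟧) (m∸n+n≡m e≤n) ⟩
      ⟦ n + toℕ i ⟧                  ≡⟨ ⟦n+a⟧ (toℕ i) ⟩
      ⟦ toℕ i ⟧                      ≡⟨ ⟦toℕ⟧ i ⟩
      i                              ∎
      where open ≡-Reasoning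

    rotate-injective : ∀ {i j} → rotate i ≡ rotate j → i ≡ j
    rotate-injective {i} {j} eq = trans (sym (unrotate-rotate i)) (trans (cong unrotate eq) (unrotate-rotate j))

    rotate-suc : ∀ i → rotate ⟦ 1 + toℕ i ⟧ ≡ ⟦ 1 + toℕ (rotate i) ⟧
    rotate-suc i = begin
      ⟦ e + toℕ ⟦ 1 + toℕ i ⟧ ⟧  ≡⟨ ⟦a+toℕ⟦b⟧⟧ e _ ⟩
      ⟦ e + (1 + toℕ i) ⟧        ≡⟨ cong ⟦_⟧ (x+[y+z]≡y+[x+z] e 1 (toℕ i)) ⟩
      ⟦ 1 + (e + toℕ i) ⟧        ≡⟨ ⟦a+toℕ⟦b⟧⟧ 1 _ ⟨
      ⟦ 1 + toℕ (rotate i) ⟧     ∎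
      where open ≡-Reasoning

    rotate-CycSucc : ∀ {i j} → CycSucc n i j ⇔ CycSucc n (rotate i) (rotate j)
    rotate-CycSucc {i} = mk⇔
      (λ c → from CycSucc⇔ (trans (cong rotate (to CycSucc⇔ c)) (rotate-suc i)))
      (λ c → from CycSucc⇔ (rotate-injective (trans (to CycSucc⇔ c) (sym (rotate-suc i)))))
      where open Equivalence

    rotation : Automorphism n
    rotation = record
      { perm = mk↔ₛ′ (map₂ rotate) (map₂ unrotate) (λ (b , i) → cong (b ,_) (rotate-unrotate i))
                     (λ (b , i) → cong (b ,_) (unrotate-rotate i))
      ; preserves = λ _ _ → mk⇔
          (Sum.map (map₂ (Sum.map (to rotate-CycSucc) (to rotate-CycSucc))) (map₂ (cong rotate)))
          (Sum.map (map₂ (Sum.map (from rotate-CycSucc) (from rotate-CycSucc))) (map₂ rotate-injective))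
      }
      where open Equivalence

  module Long (5≤n : 5 ≤ n) where

    <n : ∀ d → T (d <ᵇ 5) → d < n
    <n d d<5 = <-≤-trans (<ᵇ⇒< d 5 d<5) 5≤n

    n∸1<n : n ∸ 1 < n
    n∸1<n = subst (n ∸ 1 <_) 1+[n∸1]≡n ≤-refl

    n∸1≢ : ∀ d → T (d <ᵇ 4) → n ∸ 1 ≢ d
    n∸1≢ d d<4 = >⇒≢ (<-≤-trans (<ᵇ⇒< d 4 d<4) (∸-monoˡ-≤ 1 5≤n))

    ⟦m⟧≢⟦1+m⟧ : ∀ m → ⟦ m ⟧ ≢ ⟦ 1 + m ⟧
    ⟦m⟧≢⟦1+m⟧ m = ⟦⟧-distinct m (<n 0 _) (<n 1 _) (λ ())

    ⟦2+m⟧≢⟦1+m⟧ : ∀ m → ⟦ 2 + m ⟧ ≢ ⟦ 1 + m ⟧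
    ⟦2+m⟧≢⟦1+m⟧ m = ⟦⟧-distinct m (<n 2 _) (<n 1 _) (λ ())

    N-twins-common : ∀ {s a b y} → InN n (s , ⟦ a ⟧) y → InN n (not s , ⟦ a ⟧) y →
      InN n (s , b) y → b ≢ ⟦ a ⟧ → y ≡ (s , ⟦ a ⟧)
    N-twins-common {s} {a} y∈N y∈N′ y∈N″ b≢a with closedNeighbourhood y∈N
    ... | inj₁ e = e
    ... | inj₂ (inj₂ (inj₂ refl)) = ⊥-elim (b≢a (N-other-side s≢not-s y∈N″))
    ... | inj₂ (inj₁ refl) =
      ⊥-elim (⟦⟧-distinct a (<n 1 _) (<n 0 _) (λ ()) (sym (N-other-side not-s≢s y∈N′)))
    ... | inj₂ (inj₂ (inj₁ refl)) =
      ⊥-elim (⟦⟧-distinct a n∸1<n (<n 0 _) (n∸1≢ 0 _) (sym (N-other-side not-s≢s y∈N′)))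

    N-around-far : ∀ {s m} d → d < n → d ≢ 2 → d ≢ 3 →
      InN n (s , ⟦ 2 + m ⟧) (s , ⟦ d + m ⟧) → ⟦ d + m ⟧ ≡ ⟦ 1 + m ⟧
    N-around-far {s} {m} d d<n d≢2 d≢3 y∈N with closedNeighbourhood y∈N
    ... | inj₁ e = ⊥-elim (⟦⟧-distinct m d<n (<n 2 _) d≢2 (cong proj₂ e))
    ... | inj₂ (inj₁ e) = ⊥-elim (⟦⟧-distinct m d<n (<n 3 _) d≢3 (cong proj₂ e))
    ... | inj₂ (inj₂ (inj₁ e)) = trans (cong proj₂ e) (⟦n∸1+[1+a]⟧ (1 + m))
    ... | inj₂ (inj₂ (inj₂ e)) = ⊥-elim (s≢not-s (cong proj₁ e))

    N-around-common : ∀ {s m y} → InN n (s , ⟦ m ⟧) y → InN n (s , ⟦ 2 + m ⟧) y → y ≡ (s , ⟦ 1 + m ⟧)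
    N-around-common {s} {m} y∈N y∈N′ with closedNeighbourhood y∈N
    ... | inj₂ (inj₁ e) = e
    ... | inj₁ refl = cong (s ,_) (N-around-far 0 (<n 0 _) (λ ()) (λ ()) y∈N′)
    ... | inj₂ (inj₂ (inj₁ refl)) = cong (s ,_) (N-around-far (n ∸ 1) n∸1<n (n∸1≢ 2 _) (n∸1≢ 3 _) y∈N′)
    ... | inj₂ (inj₂ (inj₂ refl)) =
      ⊥-elim (⟦⟧-distinct m (<n 2 _) (<n 0 _) (λ ()) (N-other-side s≢not-s y∈N′))

-- Finite sums

∑ : ℕ → (ℕ → ℕ) → ℕ
∑ zero    f = 0
∑ (suc n) f = f 0 + ∑ n (f ∘ suc)

∑-cong : ∀ n {f g} → (∀ i → f i ≡ g i) → ∑ n f ≡ ∑ n g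
∑-cong zero    f≗g = refl
∑-cong (suc n) f≗g = cong₂ _+_ (f≗g 0) (∑-cong n (f≗g ∘ suc))

∑-+ : ∀ n f g → ∑ n (λ i → f i + g i) ≡ ∑ n f + ∑ n g
∑-+ zero    f g = refl
∑-+ (suc n) f g = trans (cong (f 0 + g 0 +_) (∑-+ n (f ∘ suc) (g ∘ suc))) (+-interchange (f 0) (g 0) _ _)

∑-++ : ∀ m n f → ∑ (m + n) f ≡ ∑ m f + ∑ n (λ i → f (m + i))
∑-++ zero    n f = refl
∑-++ (suc m) n f = trans (cong (f 0 +_) (∑-++ m n (f ∘ suc))) (sym (+-assoc (f 0) _ _))

∑-snoc : ∀ n f → ∑ (suc n) f ≡ ∑ n f + f n
∑-snoc zero    f = +-comm (f 0) 0
∑-snoc (suc n) f = trans (cong (f 0 +_) (∑-snoc n (f ∘ suc))) (sym (+-assoc (f 0) _ _))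

∑-const : ∀ n {c f} → (∀ i → f i ≡ c) → ∑ n f ≡ n * c
∑-const zero    f≗c = refl
∑-const (suc n) f≗c = cong₂ _+_ (f≗c 0) (∑-const n (f≗c ∘ suc))

∑-shift : ∀ n a f → (∀ i → f (n + i) ≡ f i) → ∑ n (λ i → f (a + i)) ≡ ∑ n f
∑-shift n zero    f periodic = refl
∑-shift n (suc a) f periodic = trans (∑-shift n a (f ∘ suc) periodic′) (+-cancelˡ-≡ (f 0) _ _ (begin
  f 0 + ∑ n (f ∘ suc)  ≡⟨ ∑-snoc n f ⟩
  ∑ n f + f n          ≡⟨ cong (λ i → ∑ n f + f i) (+-identityʳ n) ⟨
  ∑ n f + f (n + 0)    ≡⟨ cong (∑ n f +_) (periodic 0) ⟩
  ∑ n f + f 0          ≡⟨ +-comm (∑ n f) (f 0) ⟩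
  f 0 + ∑ n f          ∎))
  where
  open ≡-Reasoning
  periodic′ : ∀ i → f (suc (n + i)) ≡ f (suc i)
  periodic′ i = trans (cong f (sym (+-suc n i))) (periodic (suc i))

∑-concat : ∀ k d f → ∑ (k * d) f ≡ ∑ k (λ j → ∑ d (λ i → f (j * d + i)))
∑-concat zero    d f = refl
∑-concat (suc k) d f = begin
  ∑ (d + k * d) f                                      ≡⟨ ∑-++ d (k * d) f ⟩
  ∑ d f + ∑ (k * d) (λ i → f (d + i))                  ≡⟨ cong (∑ d f +_) (∑-concat k d _) ⟩
  ∑ d f + ∑ k (λ j → ∑ d (λ i → f (d + (j * d + i))))  ≡⟨ cong (∑ d f +_) (∑-cong k λ j →
                                                            ∑-cong d λ i → cong f (+-assoc d (j * d) i)) ⟨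
  ∑ d f + ∑ k (λ j → ∑ d (λ i → f (d + j * d + i)))    ∎
  where open ≡-Reasoning

∑-lower-bound : ∀ n {c f} → (∀ i → c ≤ f i) → n * c ≤ ∑ n f
∑-lower-bound zero    c≤f = z≤n
∑-lower-bound (suc n) c≤f = +-mono-≤ (c≤f 0) (∑-lower-bound n (c≤f ∘ suc))

∑-tight-head : ∀ n {c f} → (∀ i → c ≤ f i) → ∑ (suc n) f ≤ suc n * c → f 0 ≤ c
∑-tight-head n {c} {f} c≤f ∑f≤ = +-cancelʳ-≤ (n * c) (f 0) c (begin
  f 0 + n * c          ≤⟨ +-monoʳ-≤ (f 0) (∑-lower-bound n (c≤f ∘ suc)) ⟩
  f 0 + ∑ n (f ∘ suc)  ≤⟨ ∑f≤ ⟩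
  c + n * c            ∎)
  where open ≤-Reasoning

sum-tabulate : ∀ n (f : ℕ → ℕ) → sum (tabulate {n = n} (f ∘ toℕ)) ≡ ∑ n f
sum-tabulate zero    f = refl
sum-tabulate (suc n) f = cong (f 0 +_) (sum-tabulate n (f ∘ suc))

x+y≡4⇒x≡2 : ∀ {x y} → 2 ≤ x → 2 ≤ y → x + y ≡ 4 → x ≡ 2
x+y≡4⇒x≡2 {x} 2≤x 2≤y x+y≡4 =
  ≤-antisym (+-cancelʳ-≤ 2 x 2 (≤-trans (+-monoʳ-≤ x 2≤y) (≤-reflexive x+y≡4))) 2≤x

-- Boolean sequences

χ : Bool → ℕ
χ b = if b then 1 else 0

χ-injective : ∀ {a b} → χ a ≡ χ b → a ≡ b
χ-injective {false} {false} _ = refl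
χ-injective {true}  {true}  _ = refl

≡-from-false : ∀ {x y : Bool} → (x ≡ false → y ≡ false) → (y ≡ false → x ≡ false) → x ≡ y
≡-from-false {false}         x⇒y _   = sym (x⇒y refl)
≡-from-false {true}  {false} _   y⇒x = y⇒x refl
≡-from-false {true}  {true}  _   _   = refl

notMultipleOf3 : ℕ → Bool
notMultipleOf3 a = not (a % 3 ≡ᵇ 0)

notMultipleOf3-window : ∀ m → (notMultipleOf3 m , notMultipleOf3 (1 + m) , notMultipleOf3 (2 + m))
  ≡ (notMultipleOf3 (m % 3) , notMultipleOf3 (1 + m % 3) , notMultipleOf3 (2 + m % 3))
notMultipleOf3-window m = cong₂ _,_ (residue 0) (cong₂ _,_ (residue 1) (residue 2))
  where
  residue : ∀ d → notMultipleOf3 (d + m) ≡ notMultipleOf3 (d + m % 3)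
  residue d = cong (λ r → not (r ≡ᵇ 0)) (Cycle.%-congˡ-+ 3 d (sym (m%n%n≡m%n m 3)))

notMultipleOf3-two-of-three : ∀ m →
  χ (notMultipleOf3 m) + χ (notMultipleOf3 (1 + m)) + χ (notMultipleOf3 (2 + m)) ≡ 2
notMultipleOf3-two-of-three m =
  subst (λ (l , c , r) → χ l + χ c + χ r ≡ 2) (sym (notMultipleOf3-window m)) (by-residue (m % 3) (m%n<n m 3))
  where
  by-residue : ∀ r → r < 3 → χ (notMultipleOf3 r) + χ (notMultipleOf3 (1 + r)) + χ (notMultipleOf3 (2 + r)) ≡ 2
  by-residue 0 _ = refl
  by-residue 1 _ = refl
  by-residue 2 _ = refl
  by-residue (suc (suc (suc _))) (s≤s (s≤s (s≤s ())))

period-3⇒shifted-pattern : ∀ (z : ℕ → Bool) e → (∀ a → z (3 + a) ≡ z a) →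
  z (e + 0) ≡ false → z (e + 1) ≡ true → z (e + 2) ≡ true → ∀ t → z (e + t) ≡ notMultipleOf3 t
period-3⇒shifted-pattern z e periodic z₀ z₁ z₂ 0 = z₀
period-3⇒shifted-pattern z e periodic z₀ z₁ z₂ 1 = z₁
period-3⇒shifted-pattern z e periodic z₀ z₁ z₂ 2 = z₂
period-3⇒shifted-pattern z e periodic z₀ z₁ z₂ (suc (suc (suc t))) = begin
  z (e + (3 + t))           ≡⟨ cong z (x+[y+z]≡y+[x+z] e 3 t) ⟩
  z (3 + (e + t))           ≡⟨ periodic (e + t) ⟩
  z (e + t)                 ≡⟨ period-3⇒shifted-pattern z e periodic z₀ z₁ z₂ t ⟩
  notMultipleOf3 t          ≡⟨ cong (λ r → not (r ≡ᵇ 0)) (trans (cong (_% 3) (+-comm 3 t)) ([m+n]%n≡m%n t 3)) ⟨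
  notMultipleOf3 (3 + t)    ∎
  where open ≡-Reasoning

module _ (z : ℕ → Bool) (two : ∀ a → χ (z a) + χ (z (1 + a)) + χ (z (2 + a)) ≡ 2) where

  two-of-three⇒period-3 : ∀ a → z (3 + a) ≡ z a
  two-of-three⇒period-3 a = χ-injective (+-cancelˡ-≡ (χ (z (1 + a)) + χ (z (2 + a))) _ _ (begin
    χ (z (1 + a)) + χ (z (2 + a)) + χ (z (3 + a))  ≡⟨ two (1 + a) ⟩
    2                                              ≡⟨ two a ⟨
    χ (z a) + χ (z (1 + a)) + χ (z (2 + a))        ≡⟨ x+y+z≡y+z+x (χ (z a)) _ _ ⟩
    χ (z (1 + a)) + χ (z (2 + a)) + χ (z a)        ∎))
    where open ≡-Reasoning

  two-of-three⇒shifted-pattern : ∃ λ e → e < 3 × ∀ t → z (e + t) ≡ notMultipleOf3 t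
  two-of-three⇒shifted-pattern with z 0 in z₀ | z 1 in z₁ | z 2 in z₂ | two 0
  ... | false | true  | true  | _ = 0 , <ᵇ⇒< 0 3 _ ,
    period-3⇒shifted-pattern z 0 two-of-three⇒period-3 z₀ z₁ z₂
  ... | true  | false | true  | _ = 1 , <ᵇ⇒< 1 3 _ ,
    period-3⇒shifted-pattern z 1 two-of-three⇒period-3 z₁ z₂ (trans (two-of-three⇒period-3 0) z₀)
  ... | true  | true  | false | _ = 2 , <ᵇ⇒< 2 3 _ ,
    period-3⇒shifted-pattern z 2 two-of-three⇒period-3 z₂ (trans (two-of-three⇒period-3 0) z₀)
      (trans (two-of-three⇒period-3 1) z₁)
  ... | false | false | false | ()
  ... | false | false | true  | ()
  ... | false | true  | false | ()
  ... | true  | false | false | ()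
  ... | true  | true  | true  | ()

-- Self-identifying codes of the prism

image-of-pullback : ∀ {n} (σ : Automorphism n) {S D : VSet n} →
  (∀ v → S (Inverse.to (Automorphism.perm σ) v) ≡ D v) → ∀ w → (S w ≡ true) ⇔ (w ∈Image[ σ , D ])
image-of-pullback σ {S} S∘σ≗D w = mk⇔
  (λ w∈S → from w , trans (sym (S∘σ≗D (from w))) (trans (cong S (strictlyInverseˡ w)) w∈S) ,
             strictlyInverseˡ w)
  (λ { (v , v∈D , refl) → trans (S∘σ≗D v) v∈D })
  where open Inverse (Automorphism.perm σ)

identifies : (left self right twin : Bool) → Bool
identifies left self right twin = (left ∧ right) ∨ ((left ∨ right) ∧ twin ∧ self)

identifies⇒2≤weight : ∀ l c r t → T (identifies l c r t) → 2 ≤ χ l + χ r + χ t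
identifies⇒2≤weight true  c true  t     _ = s≤s (s≤s z≤n)
identifies⇒2≤weight true  c false true  _ = s≤s (s≤s z≤n)
identifies⇒2≤weight false c true  true  _ = s≤s (s≤s z≤n)
identifies⇒2≤weight true  c false false ()
identifies⇒2≤weight false c true  false ()
identifies⇒2≤weight false c false t     ()

identifies-without-self : ∀ l r t → T (identifies l false r t) → (l ≡ true) × (r ≡ true)
identifies-without-self true  true  t     _ = refl , refl
identifies-without-self true  false false ()
identifies-without-self true  false true  ()
identifies-without-self false true  false ()
identifies-without-self false true  true  ()
identifies-without-self false false t     ()

notMultipleOf3-identifies : ∀ m →
  T (identifies (notMultipleOf3 m) (notMultipleOf3 (1 + m)) (notMultipleOf3 (2 + m)) (notMultipleOf3 (1 + m)))
notMultipleOf3-identifies m =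
  subst (λ (l , c , r) → T (identifies l c r c)) (sym (notMultipleOf3-window m)) (by-residue (m % 3) (m%n<n m 3))
  where
  by-residue : ∀ r → r < 3 →
    T (identifies (notMultipleOf3 r) (notMultipleOf3 (1 + r)) (notMultipleOf3 (2 + r)) (notMultipleOf3 (1 + r)))
  by-residue 0 _ = _
  by-residue 1 _ = _
  by-residue 2 _ = _
  by-residue (suc (suc (suc _))) (s≤s (s≤s (s≤s ())))

module Code (n : ℕ) .{{_ : NonZero n}} (S : VSet n) where
  open Cycle n

  Identified : Bool → ℕ → Set
  Identified s m =
    T (identifies (S (s , ⟦ m ⟧)) (S (s , ⟦ 1 + m ⟧)) (S (s , ⟦ 2 + m ⟧)) (S (not s , ⟦ 1 + m ⟧)))

  IsSICAt : V n → Set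
  IsSICAt x = (∃ λ v → (S v ≡ true) × InN n x v)
    × ((y : V n) → ((v : V n) → S v ≡ true → InN n x v → InN n v y) ⇔ (y ≡ x))

  CannotExclude : V n → V n → Set
  CannotExclude v y = S v ≡ false ⊎ InN n v y

  centre-in-⋂N : ∀ {x y} → y ≡ x → (v : V n) → S v ≡ true → InN n x v → InN n v y
  centre-in-⋂N refl _ _ = InN-sym

  confused : ∀ {s m} → IsSICAt (s , ⟦ 1 + m ⟧) → (y : V n) → y ≢ (s , ⟦ 1 + m ⟧) →
    CannotExclude (s , ⟦ 1 + m ⟧) y → CannotExclude (s , ⟦ 2 + m ⟧) y → CannotExclude (s , ⟦ m ⟧) y →
    CannotExclude (not s , ⟦ 1 + m ⟧) y → ⊥
  confused {s} {m} (_ , separates) y y≢x self right left twin = y≢x (Equivalence.to (separates y) covered)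
    where
    included : ∀ {v} → S v ≡ true → CannotExclude v y → InN n v y
    included v∈S (inj₁ v∉S) = ⊥-elim (case trans (sym v∈S) v∉S of λ ())
    included _   (inj₂ v∼y) = v∼y
    covered : (v : V n) → S v ≡ true → InN n (s , ⟦ 1 + m ⟧) v → InN n v y
    covered v v∈S x∼v with closedNeighbourhood-1+ x∼v
    ... | inj₁ refl = included v∈S self
    ... | inj₂ (inj₁ refl) = included v∈S right
    ... | inj₂ (inj₂ (inj₁ refl)) = included v∈S left
    ... | inj₂ (inj₂ (inj₂ refl)) = included v∈S twin

  module _ (5≤n : 5 ≤ n) where
    open Cycle.Long n 5≤n

    IsSIC⇒Identified : IsSIC n S → ∀ s m → Identified s m
    IsSIC⇒Identified sic s m
      with S (s , ⟦ m ⟧) in l | S (s , ⟦ 1 + m ⟧) in c | S (s , ⟦ 2 + m ⟧) in r | S (not s , ⟦ 1 + m ⟧) in t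
    ... | true  | _     | true  | _     = _
    ... | true  | true  | false | true  = _
    ... | false | true  | true  | true  = _
    ... | false | _     | false | _     = ⊥-elim (confused (sic _) (not s , ⟦ 1 + m ⟧) (not-s≢s ∘ cong proj₁)
      (inj₂ N-twin) (inj₁ r) (inj₁ l) (inj₂ (inj₁ refl)))
    ... | true  | _     | false | false = ⊥-elim (confused (sic _) (s , ⟦ m ⟧) (⟦m⟧≢⟦1+m⟧ m ∘ cong proj₂)
      (inj₂ (N-pred m)) (inj₁ r) (inj₂ (inj₁ refl)) (inj₁ t))
    ... | true  | false | false | true  = ⊥-elim (confused (sic _) (not s , ⟦ m ⟧) (not-s≢s ∘ cong proj₁)
      (inj₁ c) (inj₁ r) (inj₂ N-twin) (inj₂ (N-pred m)))
    ... | false | _     | true  | false = ⊥-elim (confused (sic _) (s , ⟦ 2 + m ⟧) (⟦2+m⟧≢⟦1+m⟧ m ∘ cong proj₂)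
      (inj₂ (N-succ (1 + m))) (inj₂ (inj₁ refl)) (inj₁ l) (inj₁ t))
    ... | false | false | true  | true  = ⊥-elim (confused (sic _) (not s , ⟦ 2 + m ⟧) (not-s≢s ∘ cong proj₁)
      (inj₁ c) (inj₂ N-twin) (inj₁ l) (inj₂ (N-succ (1 + m))))

    Identified⇒IsSICAt : ∀ s m → Identified s m → IsSICAt (s , ⟦ 1 + m ⟧)
    Identified⇒IsSICAt s m identified
      with S (s , ⟦ m ⟧) in l | S (s , ⟦ 1 + m ⟧) in c | S (s , ⟦ 2 + m ⟧) in r | S (not s , ⟦ 1 + m ⟧) in t
         | identified
    ... | true  | _     | true  | _     | _ = ((s , ⟦ m ⟧) , l , N-pred m) , λ y → mk⇔
      (λ H → N-around-common (H _ l (N-pred m)) (H _ r (N-succ (1 + m)))) centre-in-⋂N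
    ... | true  | true  | false | true  | _ = ((s , ⟦ 1 + m ⟧) , c , inj₁ refl) , λ y → mk⇔
      (λ H → N-twins-common (H _ c (inj₁ refl)) (H _ t N-twin) (H _ l (N-pred m)) (⟦m⟧≢⟦1+m⟧ m)) centre-in-⋂N
    ... | false | true  | true  | true  | _ = ((s , ⟦ 1 + m ⟧) , c , inj₁ refl) , λ y → mk⇔
      (λ H → N-twins-common (H _ c (inj₁ refl)) (H _ t N-twin) (H _ r (N-succ (1 + m))) (⟦2+m⟧≢⟦1+m⟧ m))
      centre-in-⋂N
    ... | true  | _     | false | false | ()
    ... | true  | false | false | true  | ()
    ... | false | _     | false | _     | ()
    ... | false | _     | true  | false | ()
    ... | false | false | true  | true  | ()

    Identified⇒IsSIC : (∀ s m → Identified s m) → IsSIC n S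
    Identified⇒IsSIC identified (s , i) =
      subst (λ j → IsSICAt (s , j)) (trans (⟦1+[n∸1+a]⟧ (toℕ i)) (⟦toℕ⟧ i)) (Identified⇒IsSICAt s _ (identified s _))

  χS : Bool → ℕ → ℕ
  χS s a = χ (S (s , ⟦ a ⟧))

  weight : Bool → ℕ → ℕ
  weight s m = χS s m + χS s (2 + m) + χS (not s) (1 + m)

  column : ℕ → ℕ
  column a = χS false a + χS true a

  window : ℕ → ℕ
  window a = ∑ 3 (λ i → column (i + a))

  window≡weights : ∀ a → window a ≡ weight false a + weight true a
  window≡weights a = regroup (χS false a) (χS true a) (χS false (1 + a)) (χS true (1 + a))
    (χS false (2 + a)) (χS true (2 + a))
    where
    regroup : ∀ x₀ y₀ x₁ y₁ x₂ y₂ → x₀ + y₀ + (x₁ + y₁ + (x₂ + y₂ + 0)) ≡ x₀ + x₂ + y₁ + (y₀ + y₂ + x₁)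
    regroup = solve-∀

  card≡∑column : card n S ≡ ∑ n column
  card≡∑column = begin
    card n S                                            ≡⟨ cong sum (map-++ χ∘S (side false) (side true)) ⟩
    sum (map χ∘S (side false) ++ map χ∘S (side true))   ≡⟨ sum-++ (map χ∘S (side false)) _ ⟩
    sum (map χ∘S (side false)) + sum (map χ∘S (side true))
                                                        ≡⟨ cong₂ _+_ (sum-side false) (sum-side true) ⟩
    ∑ n (χS false) + ∑ n (χS true)                      ≡⟨ ∑-+ n _ _ ⟨
    ∑ n column                                          ∎
    where
    open ≡-Reasoning
    χ∘S : V n → ℕ
    χ∘S v = χ (S v)
    side : Bool → List (V n)
    side b = map (b ,_) (allFin n)
    sum-side : ∀ b → sum (map χ∘S (side b)) ≡ ∑ n (χS b)
    sum-side b = begin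
      sum (map χ∘S (map (b ,_) (tabulate (λ i → i))))  ≡⟨ cong (sum ∘ map χ∘S) (map-tabulate (λ i → i) (b ,_)) ⟩
      sum (map χ∘S (tabulate (b ,_)))                 ≡⟨ cong sum (map-tabulate (b ,_) χ∘S) ⟩
      sum (tabulate (χ∘S ∘ (b ,_)))                   ≡⟨ cong sum (tabulate-cong (cong (χ∘S ∘ (b ,_)) ∘ ⟦toℕ⟧)) ⟨
      sum (tabulate {n = n} (χS b ∘ toℕ))             ≡⟨ sum-tabulate n (χS b) ⟩
      ∑ n (χS b)                                      ∎

  card≡∑windows : ∀ k → n ≡ 3 * k → ∀ a → card n S ≡ ∑ k (λ j → window (j * 3 + a))
  card≡∑windows k n≡3k a = begin
    card n S                                          ≡⟨ card≡∑column ⟩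
    ∑ n column                                        ≡⟨ ∑-shift n a column column-periodic ⟨
    ∑ n (λ i → column (a + i))                        ≡⟨ cong (λ m → ∑ m (column ∘ (a +_))) n≡k*3 ⟩
    ∑ (k * 3) (λ i → column (a + i))                  ≡⟨ ∑-concat k 3 _ ⟩
    ∑ k (λ j → ∑ 3 (λ i → column (a + (j * 3 + i))))  ≡⟨ ∑-cong k (λ j → ∑-cong 3 λ i →
                                                           cong column (x+[y+z]≡z+[y+x] a (j * 3) i)) ⟩
    ∑ k (λ j → window (j * 3 + a))                    ∎
    where
    open ≡-Reasoning
    column-periodic : ∀ i → column (n + i) ≡ column i
    column-periodic i = cong (λ j → χ (S (false , j)) + χ (S (true , j))) (⟦n+a⟧ i)
    n≡k*3 : n ≡ k * 3
    n≡k*3 = trans n≡3k (*-comm 3 k)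

  module _ (identified : ∀ s m → Identified s m) where

    2≤weight : ∀ s m → 2 ≤ weight s m
    2≤weight s m = identifies⇒2≤weight (S (s , ⟦ m ⟧)) (S (s , ⟦ 1 + m ⟧)) (S (s , ⟦ 2 + m ⟧))
      (S (not s , ⟦ 1 + m ⟧)) (identified s m)

    4≤window : ∀ a → 4 ≤ window a
    4≤window a = subst (4 ≤_) (sym (window≡weights a)) (+-mono-≤ (2≤weight false a) (2≤weight true a))

    4k≤card : ∀ k → n ≡ 3 * k → 4 * k ≤ card n S
    4k≤card k n≡3k = begin
      4 * k                               ≡⟨ *-comm 4 k ⟩
      k * 4                               ≤⟨ ∑-lower-bound k (λ j → 4≤window (j * 3 + 0)) ⟩
      ∑ k (λ j → window (j * 3 + 0))      ≡⟨ card≡∑windows k n≡3k 0 ⟨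
      card n S                            ∎
      where open ≤-Reasoning

    card≡4k⇒window≡4 : ∀ k → n ≡ 3 * k → card n S ≡ 4 * k → ∀ a → window a ≡ 4
    card≡4k⇒window≡4 zero    n≡0  _        _ = ⊥-elim (≢-nonZero⁻¹ n n≡0)
    card≡4k⇒window≡4 (suc k) n≡3k card≡4k a =
      ≤-antisym (∑-tight-head k (λ j → 4≤window (j * 3 + a)) windows≤) (4≤window a)
      where
      open ≤-Reasoning
      windows≤ : ∑ (suc k) (λ j → window (j * 3 + a)) ≤ suc k * 4
      windows≤ = begin
        ∑ (suc k) (λ j → window (j * 3 + a))  ≡⟨ card≡∑windows (suc k) n≡3k a ⟨
        card n S                              ≡⟨ card≡4k ⟩
        4 * suc k                             ≡⟨ *-comm 4 (suc k) ⟩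
        suc k * 4                             ∎

    module _ (window≡4 : ∀ a → window a ≡ 4) where

      weight≡2 : ∀ s m → weight s m ≡ 2
      weight≡2 false m = x+y≡4⇒x≡2 (2≤weight false m) (2≤weight true m)
        (trans (sym (window≡weights m)) (window≡4 m))
      weight≡2 true  m = x+y≡4⇒x≡2 (2≤weight true m) (2≤weight false m)
        (trans (+-comm (weight true m) _) (trans (sym (window≡weights m)) (window≡4 m)))

      vacant⇒twin-vacant : ∀ s m → S (s , ⟦ 1 + m ⟧) ≡ false → S (not s , ⟦ 1 + m ⟧) ≡ false
      vacant⇒twin-vacant s m vacant with identifies-without-self (S (s , ⟦ m ⟧)) (S (s , ⟦ 2 + m ⟧)) t
        (subst (λ c → T (identifies (S (s , ⟦ m ⟧)) c (S (s , ⟦ 2 + m ⟧)) t)) vacant (identified s m))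
        where
        t : Bool
        t = S (not s , ⟦ 1 + m ⟧)
      ... | l≡true , r≡true = χ-injective (+-cancelˡ-≡ 2 (χS (not s) (1 + m)) 0 (begin
        2 + χS (not s) (1 + m)  ≡⟨ cong₂ (λ l r → χ l + χ r + χS (not s) (1 + m)) l≡true r≡true ⟨
        weight s m              ≡⟨ weight≡2 s m ⟩
        2                       ∎))
        where open ≡-Reasoning

      twins-agree : ∀ a → S (true , ⟦ a ⟧) ≡ S (false , ⟦ a ⟧)
      twins-agree a = subst (λ i → S (true , i) ≡ S (false , i)) (⟦1+[n∸1+a]⟧ a)
        (≡-from-false (vacant⇒twin-vacant true (n ∸ 1 + a)) (vacant⇒twin-vacant false (n ∸ 1 + a)))

      two-of-every-three : ∀ a → χS false a + χS false (1 + a) + χS false (2 + a) ≡ 2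
      two-of-every-three a = begin
        χS false a + χS false (1 + a) + χS false (2 + a)  ≡⟨ x+y+z≡x+z+y (χS false a) _ _ ⟩
        χS false a + χS false (2 + a) + χS false (1 + a)  ≡⟨ cong (λ b → χS false a + χS false (2 + a) + χ b)
                                                               (twins-agree (1 + a)) ⟨
        weight false a                                    ≡⟨ weight≡2 false a ⟩
        2                                                 ∎
        where open ≡-Reasoning

      rotated-D₀ : 3 ≤ n → Σ (Automorphism n) λ σ → ∀ w → (S w ≡ true) ⇔ (w ∈Image[ σ , D₀ n ])
      rotated-D₀ 3≤n with two-of-three⇒shifted-pattern (λ a → S (false , ⟦ a ⟧)) two-of-every-three
      ... | e , e<3 , shifted = rotation , image-of-pullback rotation S∘rotation≗D₀
        where
        open Rotation e (≤-trans (<⇒≤ e<3) 3≤n)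
        S∘rotation≗D₀ : ∀ v → S (Inverse.to (Automorphism.perm rotation) v) ≡ D₀ n v
        S∘rotation≗D₀ (false , j) = shifted (toℕ j)
        S∘rotation≗D₀ (true  , j) = trans (twins-agree (e + toℕ j)) (shifted (toℕ j))

module D₀-Code (k : ℕ) .{{_ : NonZero (3 * k)}} where
  open Cycle (3 * k)
  open Code (3 * k) (D₀ (3 * k))

  D₀-⟦⟧ : ∀ s a → D₀ (3 * k) (s , ⟦ a ⟧) ≡ notMultipleOf3 a
  D₀-⟦⟧ s a = cong (λ r → not (r ≡ᵇ 0))
    (trans (cong (_% 3) (toℕ-⟦⟧ a)) (m∣n⇒o%n%m≡o%m 3 (3 * k) a (m∣m*n k)))

  D₀-identified : ∀ s m → Identified s m
  D₀-identified s m rewrite D₀-⟦⟧ s m | D₀-⟦⟧ s (1 + m) | D₀-⟦⟧ s (2 + m) = notMultipleOf3-identifies m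

  D₀-isSIC : 5 ≤ 3 * k → IsSIC (3 * k) (D₀ (3 * k))
  D₀-isSIC 5≤n = Identified⇒IsSIC 5≤n D₀-identified

  D₀-window≡4 : ∀ a → window a ≡ 4
  D₀-window≡4 a = trans (window≡weights a) (cong₂ _+_ (D₀-weight false) (D₀-weight true))
    where
    D₀-weight : ∀ s → weight s a ≡ 2
    D₀-weight s rewrite D₀-⟦⟧ s a | D₀-⟦⟧ s (1 + a) | D₀-⟦⟧ s (2 + a) =
      trans (x+y+z≡x+z+y (χ (notMultipleOf3 a)) _ _) (notMultipleOf3-two-of-three a)

  card-D₀ : card (3 * k) (D₀ (3 * k)) ≡ 4 * k
  card-D₀ = trans (card≡∑windows k refl 0) (trans (∑-const k (λ j → D₀-window≡4 (j * 3 + 0))) (*-comm k 4))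

mainTheorem16 : (k : ℕ) → 2 ≤ k →
    ((∃ λ (S : VSet (3 * k)) → IsSIC (3 * k) S × (card (3 * k) S ≡ 4 * k))
     × ((S : VSet (3 * k)) → IsSIC (3 * k) S → 4 * k ≤ card (3 * k) S))
    × ((S : VSet (3 * k)) → IsSIC (3 * k) S → card (3 * k) S ≡ 4 * k →
        Σ (Automorphism (3 * k)) λ σ →
          (w : V (3 * k)) → (S w ≡ true) ⇔ (w ∈Image[ σ , D₀ (3 * k) ]))
mainTheorem16 k@(suc _) 2≤k = ((D₀ n , D₀-isSIC 5≤n , card-D₀) , lower-bound) , rotated-D₀
  where
  open D₀-Code k
  n : ℕ
  n = 3 * k
  5≤n : 5 ≤ n
  5≤n = ≤-trans (≤ᵇ⇒≤ 5 6 _) (*-monoʳ-≤ 3 2≤k)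
  identified : ∀ {S} → IsSIC n S → ∀ s m → Code.Identified n S s m
  identified {S} = Code.IsSIC⇒Identified n S 5≤n
  lower-bound : (S : VSet n) → IsSIC n S → 4 * k ≤ card n S
  lower-bound S sic = Code.4k≤card n S (identified sic) k refl
  rotated-D₀ : (S : VSet n) → IsSIC n S → card n S ≡ 4 * k →
    Σ (Automorphism n) λ σ → (w : V n) → (S w ≡ true) ⇔ (w ∈Image[ σ , D₀ n ])
  rotated-D₀ S sic card≡4k = Code.rotated-D₀ n S (identified sic)
    (Code.card≡4k⇒window≡4 n S (identified sic) k refl card≡4k) (≤-trans (≤ᵇ⇒≤ 3 5 _) 5≤n)
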